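{- A graph $G$ is an OAT graph if and only if every connected component of $G$ is an OAT graph.
   Context: All graphs are finite and simple. For non-adjacent vertices $u,v$, $u$ is comparable to $v$ if $N(u)\subseteq N(v)$. A graph is an OAT graph if it can be constructed from single-vertex graphs by a finite sequence of the following operations, where $G_1=(V_1,E_1)$, $G_2=(V_2,E_2)$ are vertex-disjoint OAT graphs: (1) disjoint union $(V_1\cup V_2,E_1\cup E_2)$; (2) join $(V_1\cup V_2, E_1\cup E_2\cup\{xy: x\in V_1,y\in V_2\})$; (3) adding a comparable vertex: for $v\in V_1$ and a new vertex $u\notin V_1$, form $(V_1\cup\{u\}, E_1\cup\{ux: x\in X\})$ for some $X\subseteq N(v)$; (4) attaching a clique: for a complete graph $Q=(V_Q,E_Q)$ disjoint from $G_1$ and $v\in V_1$, form $(V_1\cup V_Q, E_1\cup E_Q\cup\{qv: q\in V_Q\})$. -}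

module Defs where

open import Data.Nat using (ℕ; zero; suc; _+_)
open import Data.Fin using (Fin; zero; suc; splitAt; _≟_)
open import Data.Bool using (Bool; true; false; not)
open import Data.Sum using (_⊎_; inj₁; inj₂)
open import Data.Product using (Σ; _×_; _,_; ∃; ∃-syntax)
open import Relation.Nullary using (yes; no)
open import Relation.Nullary.Decidable using (⌊_⌋)
open import Relation.Binary.PropositionalEquality using (_≡_; refl; sym; cong)
open import Function.Bundles using (_↔_; Inverse)
open import Function.Definitions using (Injective)

record Graph (n : ℕ) : Set where
  field
    adj    : Fin n → Fin n → Bool
    adjSym : ∀ i j → adj i j ≡ adj j i
    adjIrr : ∀ i → adj i i ≡ false
open Graph public

sumAdj : ∀ {n₁ n₂} → Graph n₁ → Graph n₂ → (Fin n₁ → Fin n₂ → Bool) →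
         Fin (n₁ + n₂) → Fin (n₁ + n₂) → Bool
sumAdj {n₁} G₁ G₂ c i j with splitAt n₁ i | splitAt n₁ j
... | inj₁ a | inj₁ b = adj G₁ a b
... | inj₂ a | inj₂ b = adj G₂ a b
... | inj₁ a | inj₂ b = c a b
... | inj₂ a | inj₁ b = c b a

sumAdj-sym : ∀ {n₁ n₂} (G₁ : Graph n₁) (G₂ : Graph n₂) c i j →
             sumAdj G₁ G₂ c i j ≡ sumAdj G₁ G₂ c j i
sumAdj-sym {n₁} G₁ G₂ c i j with splitAt n₁ i | splitAt n₁ j
... | inj₁ a | inj₁ b = adjSym G₁ a b
... | inj₂ a | inj₂ b = adjSym G₂ a b
... | inj₁ a | inj₂ b = refl
... | inj₂ a | inj₁ b = refl

sumAdj-irr : ∀ {n₁ n₂} (G₁ : Graph n₁) (G₂ : Graph n₂) c i →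
             sumAdj G₁ G₂ c i i ≡ false
sumAdj-irr {n₁} G₁ G₂ c i with splitAt n₁ i
... | inj₁ a = adjIrr G₁ a
... | inj₂ a = adjIrr G₂ a

sumGraph : ∀ {n₁ n₂} → Graph n₁ → Graph n₂ → (Fin n₁ → Fin n₂ → Bool) →
           Graph (n₁ + n₂)
sumGraph G₁ G₂ c = record
  { adj = sumAdj G₁ G₂ c ; adjSym = sumAdj-sym G₁ G₂ c ; adjIrr = sumAdj-irr G₁ G₂ c }

disjointUnion : ∀ {n₁ n₂} → Graph n₁ → Graph n₂ → Graph (n₁ + n₂)
disjointUnion G₁ G₂ = sumGraph G₁ G₂ (λ _ _ → false)

join : ∀ {n₁ n₂} → Graph n₁ → Graph n₂ → Graph (n₁ + n₂)
join G₁ G₂ = sumGraph G₁ G₂ (λ _ _ → true)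

complete : (k : ℕ) → Graph k
complete k = record
  { adj = λ i j → not ⌊ i ≟ j ⌋
  ; adjSym = λ i j → symAdj i j
  ; adjIrr = λ i → irr i }
  where
  symAdj : ∀ (i j : Fin k) → not ⌊ i ≟ j ⌋ ≡ not ⌊ j ≟ i ⌋
  symAdj i j with i ≟ j | j ≟ i
  ... | yes _ | yes _ = refl
  ... | no _  | no _  = refl
  ... | yes p | no q  with q (sym p)
  ... | ()
  symAdj i j | no q | yes p with q (sym p)
  ... | ()
  irr : ∀ (i : Fin k) → not ⌊ i ≟ i ⌋ ≡ false
  irr i with i ≟ i
  ... | yes _ = refl
  ... | no q with q refl
  ... | ()

attachClique : ∀ {n} → Graph n → Fin n → (k : ℕ) → Graph (n + k)
attachClique G v k = sumGraph G (complete k) (λ a _ → ⌊ a ≟ v ⌋)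

-- Operation (3): add a new vertex (vertex zero of Fin (suc n)) adjacent
-- exactly to the vertices x with X x ≡ true (X is required to be a subset
-- of N(v) in the definition of OAT graphs below).
addVertexAdj : ∀ {n} → Graph n → (Fin n → Bool) → Fin (suc n) → Fin (suc n) → Bool
addVertexAdj G X zero    zero    = false
addVertexAdj G X zero    (suc j) = X j
addVertexAdj G X (suc i) zero    = X i
addVertexAdj G X (suc i) (suc j) = adj G i j

addVertex : ∀ {n} → Graph n → (Fin n → Bool) → Graph (suc n)
addVertex {n} G X = record { adj = addVertexAdj G X ; adjSym = s ; adjIrr = r }
  where
  s : ∀ i j → addVertexAdj G X i j ≡ addVertexAdj G X j i
  s zero zero = refl
  s zero (suc j) = refl
  s (suc i) zero = refl
  s (suc i) (suc j) = adjSym G i j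
  r : ∀ i → addVertexAdj G X i i ≡ false
  r zero = refl
  r (suc i) = adjIrr G i

K1 : Graph 1
K1 = record { adj = λ _ _ → false ; adjSym = λ _ _ → refl ; adjIrr = λ _ → refl }

_≅_ : ∀ {m n} → Graph m → Graph n → Set
_≅_ {m} {n} G H =
  Σ (Fin m ↔ Fin n) λ σ → ∀ i j → adj H (Inverse.to σ i) (Inverse.to σ j) ≡ adj G i j

-- OAT graphs.  Vertex names are immaterial, so the class is taken closed
-- under isomorphism (constructor `iso`).
data IsOAT : ∀ {n} → Graph n → Set where
  single : IsOAT K1
  iso    : ∀ {m n} {G : Graph m} {H : Graph n} → IsOAT G → G ≅ H → IsOAT H
  union  : ∀ {n₁ n₂} {G₁ : Graph n₁} {G₂ : Graph n₂} →
           IsOAT G₁ → IsOAT G₂ → IsOAT (disjointUnion G₁ G₂)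
  joinOp : ∀ {n₁ n₂} {G₁ : Graph n₁} {G₂ : Graph n₂} →
           IsOAT G₁ → IsOAT G₂ → IsOAT (join G₁ G₂)
  comparable : ∀ {n} {G : Graph n} (v : Fin n) (X : Fin n → Bool) →
           (∀ x → X x ≡ true → adj G v x ≡ true) →
           IsOAT G → IsOAT (addVertex G X)
  clique : ∀ {n} {G : Graph n} (v : Fin n) (k : ℕ) →
           IsOAT G → IsOAT (attachClique G v k)

data Reach {n} (G : Graph n) : Fin n → Fin n → Set where
  here : ∀ {u} → Reach G u u
  step : ∀ {u w v} → adj G u w ≡ true → Reach G w v → Reach G u v

-- H (on Fin m) together with f : Fin m → Fin n is (an isomorphic copy of)
-- the connected component of G containing v: f is injective, its image is
-- exactly the set of vertices reachable from v, and H is the induced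
-- subgraph on that image.
IsComponentOf : ∀ {m n} → Graph m → (Fin m → Fin n) → Graph n → Fin n → Set
IsComponentOf {m} {n} H f G v =
  Injective _≡_ _≡_ f ×
  (∀ u → Reach G v u → ∃[ i ] f i ≡ u) ×
  (∀ i → Reach G v (f i)) ×
  (∀ i j → adj H i j ≡ adj G (f i) (f j))

AllComponentsOAT : ∀ {n} → Graph n → Set
AllComponentsOAT {n} G =
  ∀ (v : Fin n) (m : ℕ) (H : Graph m) (f : Fin m → Fin n) →
  IsComponentOf H f G v → IsOAT H

module Submission where

-- Components are handled through embeddings: a component of G at v is an
-- embedding whose image is exactly the set of vertices reachable from v.
-- Hence two components of one connected piece are isomorphic, and an
-- embedding e : G → G' whose image contains everything reachable from e v
-- identifies the components of v in G and of e v in G'.  Reachability is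
-- decidable, so every vertex v splits G into its component and the rest.
--
-- (⇒) By induction on the OAT construction: single vertices and joins are
-- connected; components of isomorphic copies and disjoint unions are pulled
-- back along embeddings; after adding a comparable vertex or attaching a
-- clique at v, the new component is the component of v modified by the same
-- operation, and all other components are pulled back from the old graph.
-- (⇐) By strong induction on the number of vertices: G is the disjoint union
-- of the component of vertex 0 and a smaller (or empty) rest.

open import Defs
open import Data.Nat using (ℕ; zero; suc; _+_; _<_)
open import Data.Nat.Properties using (m≤n+m)
open import Data.Nat.Induction using (<-rec)
open import Data.Fin using (Fin; zero; suc; splitAt; _↑ˡ_; _↑ʳ_; punchIn; punchOut; lift)
  renaming (_≟_ to _≟ᶠ_; join to joinᶠ)
open import Data.Fin.Properties
  using (splitAt-↑ˡ; splitAt-↑ʳ; splitAt⁻¹-↑ˡ; splitAt⁻¹-↑ʳ; ↑ˡ-injective; ↑ʳ-injective;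
         suc-injective; lift-injective; punchIn-punchOut; punchInᵢ≢i; any?; +↔⊎)
open import Data.Fin.Permutation using (↔⇒≡)
open import Data.Bool using (Bool; true; false; T) renaming (_≟_ to _≟ᵇ_)
open import Data.Bool.Properties using (¬-not)
open import Data.Unit using (tt)
open import Data.Sum using (_⊎_; inj₁; inj₂; [_,_]′) renaming (map to map⊎; map₁ to map⊎₁)
open import Data.Sum.Properties using (inj₁-injective; inj₂-injective; swap-↔)
open import Data.Product using (_×_; _,_; ∃-syntax; proj₁; proj₂)
open import Function using (_∘_; id)
open import Function.Bundles using (_↔_; _⇔_; Inverse; mk↔ₛ′; mk⇔)
open import Function.Definitions using (Injective)
open import Function.Properties.Inverse using (↔-trans)
open import Relation.Nullary using (¬_; Dec; yes; no; contradiction)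
open import Relation.Nullary.Decidable
  using (⌊_⌋; toWitness; isYes≗does; dec-true; does-⇔; _×-dec_)
open import Relation.Unary using (Decidable)
open import Relation.Binary.PropositionalEquality
  using (_≡_; _≢_; refl; sym; trans; cong; cong₂; subst; subst₂)

variable
  m n k m₁ m₂ n₁ n₂ : ℕ

Embeds : Graph m → Graph n → (Fin m → Fin n) → Set
Embeds H G f = Injective _≡_ _≡_ f × (∀ i j → adj H i j ≡ adj G (f i) (f j))

induced : Graph n → (Fin m → Fin n) → Graph m
induced G f = record
  { adj = λ i j → adj G (f i) (f j)
  ; adjSym = λ i j → adjSym G (f i) (f j)
  ; adjIrr = λ i → adjIrr G (f i) }

ReachClosed : Graph n → (Fin m → Fin n) → Fin n → Set
ReachClosed G f x = ∀ u → Reach G x u → ∃[ i ] f i ≡ u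

ComponentsOATAt : Graph n → Fin n → Set
ComponentsOATAt G v = ∀ m (H : Graph m) f → IsComponentOf H f G v → IsOAT H

↔-injective : ∀ {A B : Set} (σ : A ↔ B) → Injective _≡_ _≡_ (Inverse.to σ)
↔-injective σ {x} {y} eq =
  trans (sym (strictlyInverseʳ x)) (trans (cong from eq) (strictlyInverseʳ y))
  where open Inverse σ

⌊≟⌋-sound : ∀ {a b : Fin n} → ⌊ a ≟ᶠ b ⌋ ≡ true → a ≡ b
⌊≟⌋-sound eq = toWitness (subst T (sym eq) tt)

⌊≟⌋-refl : ∀ (a : Fin n) → ⌊ a ≟ᶠ a ⌋ ≡ true
⌊≟⌋-refl a = trans (isYes≗does (a ≟ᶠ a)) (dec-true (a ≟ᶠ a) refl)

⌊⌋-⇔ : ∀ {A B : Set} → A ⇔ B → (a? : Dec A) (b? : Dec B) → ⌊ a? ⌋ ≡ ⌊ b? ⌋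
⌊⌋-⇔ A⇔B a? b? =
  trans (isYes≗does a?) (trans (does-⇔ A⇔B a? b?) (sym (isYes≗does b?)))

data SumView (m n : ℕ) : Fin (m + n) → Set where
  left  : (a : Fin m) → SumView m n (a ↑ˡ n)
  right : (b : Fin n) → SumView m n (m ↑ʳ b)

sumView : ∀ m n (i : Fin (m + n)) → SumView m n i
sumView m n i with splitAt m i in eq
... | inj₁ a = subst (SumView m n) (splitAt⁻¹-↑ˡ eq) (left a)
... | inj₂ b = subst (SumView m n) (splitAt⁻¹-↑ʳ eq) (right b)

↑ˡ≢↑ʳ : ∀ (a : Fin m) (b : Fin n) → a ↑ˡ n ≢ m ↑ʳ b
↑ˡ≢↑ʳ {m} {n} a b eq
  with () ← trans (sym (splitAt-↑ˡ m a n)) (trans (cong (splitAt m) eq) (splitAt-↑ʳ m n b))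

module _ {n₁ n₂} (G₁ : Graph n₁) (G₂ : Graph n₂) (c : Fin n₁ → Fin n₂ → Bool) where

  sum-ll : ∀ a b → adj (sumGraph G₁ G₂ c) (a ↑ˡ n₂) (b ↑ˡ n₂) ≡ adj G₁ a b
  sum-ll a b rewrite splitAt-↑ˡ n₁ a n₂ | splitAt-↑ˡ n₁ b n₂ = refl

  sum-rr : ∀ a b → adj (sumGraph G₁ G₂ c) (n₁ ↑ʳ a) (n₁ ↑ʳ b) ≡ adj G₂ a b
  sum-rr a b rewrite splitAt-↑ʳ n₁ n₂ a | splitAt-↑ʳ n₁ n₂ b = refl

  sum-lr : ∀ a b → adj (sumGraph G₁ G₂ c) (a ↑ˡ n₂) (n₁ ↑ʳ b) ≡ c a b
  sum-lr a b rewrite splitAt-↑ˡ n₁ a n₂ | splitAt-↑ʳ n₁ n₂ b = refl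

  sum-rl : ∀ a b → adj (sumGraph G₁ G₂ c) (n₁ ↑ʳ b) (a ↑ˡ n₂) ≡ c a b
  sum-rl a b rewrite splitAt-↑ˡ n₁ a n₂ | splitAt-↑ʳ n₁ n₂ b = refl

_⊕_ : (Fin m₁ → Fin n₁) → (Fin m₂ → Fin n₂) → Fin (m₁ + m₂) → Fin (n₁ + n₂)
_⊕_ {m₁} {n₁} {m₂} {n₂} f₁ f₂ x = joinᶠ n₁ n₂ (map⊎ f₁ f₂ (splitAt m₁ x))

⊕-left : ∀ (f₁ : Fin m₁ → Fin n₁) (f₂ : Fin m₂ → Fin n₂) a → (f₁ ⊕ f₂) (a ↑ˡ m₂) ≡ f₁ a ↑ˡ n₂
⊕-left {m₁} {m₂ = m₂} f₁ f₂ a rewrite splitAt-↑ˡ m₁ a m₂ = refl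

⊕-right : ∀ (f₁ : Fin m₁ → Fin n₁) (f₂ : Fin m₂ → Fin n₂) b → (f₁ ⊕ f₂) (m₁ ↑ʳ b) ≡ n₁ ↑ʳ f₂ b
⊕-right {m₁} {m₂ = m₂} f₁ f₂ b rewrite splitAt-↑ʳ m₁ m₂ b = refl

⊕-embeds : ∀ {H₁ : Graph m₁} {H₂ : Graph m₂} {G₁ : Graph n₁} {G₂ : Graph n₂} {f₁ f₂} c′ c →
           Embeds H₁ G₁ f₁ → Embeds H₂ G₂ f₂ → (∀ a b → c′ a b ≡ c (f₁ a) (f₂ b)) →
           Embeds (sumGraph H₁ H₂ c′) (sumGraph G₁ G₂ c) (f₁ ⊕ f₂)
⊕-embeds {m₁} {m₂} {n₁} {n₂} {H₁} {H₂} {G₁} {G₂} {f₁} {f₂} c′ c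
         (inj₁′ , pres₁) (inj₂′ , pres₂) cross = injective , preserves
  where
  F = f₁ ⊕ f₂
  S = sumGraph G₁ G₂ c

  injective : Injective _≡_ _≡_ F
  injective {x} {y} eq with sumView m₁ m₂ x | sumView m₁ m₂ y
  ... | left a | left b =
    cong (_↑ˡ m₂) (inj₁′ (↑ˡ-injective n₂ _ _
      (trans (sym (⊕-left f₁ f₂ a)) (trans eq (⊕-left f₁ f₂ b)))))
  ... | left a | right b =
    contradiction (trans (sym (⊕-left f₁ f₂ a)) (trans eq (⊕-right f₁ f₂ b))) (↑ˡ≢↑ʳ _ _)
  ... | right a | left b =
    contradiction (trans (sym (⊕-left f₁ f₂ b)) (trans (sym eq) (⊕-right f₁ f₂ a))) (↑ˡ≢↑ʳ _ _)
  ... | right a | right b =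
    cong (m₁ ↑ʳ_) (inj₂′ (↑ʳ-injective n₁ _ _
      (trans (sym (⊕-right f₁ f₂ a)) (trans eq (⊕-right f₁ f₂ b)))))

  preserves : ∀ x y → adj (sumGraph H₁ H₂ c′) x y ≡ adj S (F x) (F y)
  preserves x y with sumView m₁ m₂ x | sumView m₁ m₂ y
  ... | left a | left b =
    trans (sum-ll H₁ H₂ c′ a b) (trans (pres₁ a b)
      (trans (sym (sum-ll G₁ G₂ c (f₁ a) (f₁ b)))
             (sym (cong₂ (adj S) (⊕-left f₁ f₂ a) (⊕-left f₁ f₂ b)))))
  ... | left a | right b =
    trans (sum-lr H₁ H₂ c′ a b) (trans (cross a b)
      (trans (sym (sum-lr G₁ G₂ c (f₁ a) (f₂ b)))
             (sym (cong₂ (adj S) (⊕-left f₁ f₂ a) (⊕-right f₁ f₂ b)))))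
  ... | right a | left b =
    trans (sum-rl H₁ H₂ c′ b a) (trans (cross b a)
      (trans (sym (sum-rl G₁ G₂ c (f₁ b) (f₂ a)))
             (sym (cong₂ (adj S) (⊕-right f₁ f₂ a) (⊕-left f₁ f₂ b)))))
  ... | right a | right b =
    trans (sum-rr H₁ H₂ c′ a b) (trans (pres₂ a b)
      (trans (sym (sum-rr G₁ G₂ c (f₂ a) (f₂ b)))
             (sym (cong₂ (adj S) (⊕-right f₁ f₂ a) (⊕-right f₁ f₂ b)))))

addVertex-embeds : ∀ {H : Graph m} {G : Graph n} {f} (X : Fin n → Bool) →
                   Embeds H G f → Embeds (addVertex H (X ∘ f)) (addVertex G X) (lift 1 f)
addVertex-embeds {f = f} X (inj , pres) = lift-injective f inj 1 , preserves
  where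
  preserves : ∀ i j → addVertexAdj _ (X ∘ f) i j ≡ addVertexAdj _ X (lift 1 f i) (lift 1 f j)
  preserves zero    zero    = refl
  preserves zero    (suc j) = refl
  preserves (suc i) zero    = refl
  preserves (suc i) (suc j) = pres i j

reach-trans : ∀ {G : Graph n} {a b c} → Reach G a b → Reach G b c → Reach G a c
reach-trans here       q = q
reach-trans (step e p) q = step e (reach-trans p q)

reach-sym : ∀ {G : Graph n} {a b} → Reach G a b → Reach G b a
reach-sym here = here
reach-sym {G = G} (step {u} {w} e p) =
  reach-trans (reach-sym p) (step (trans (adjSym G w u) e) here)

reach-contract : ∀ {H : Graph m} {G : Graph n} (π : Fin m → Fin n) →
                 (∀ a b → adj H a b ≡ true → π a ≡ π b ⊎ adj G (π a) (π b) ≡ true) →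
                 ∀ {a b} → Reach H a b → Reach G (π a) (π b)
reach-contract π edge here = here
reach-contract {G = G} π edge {b = b} (step {u} {w} e r) with edge u w e
... | inj₁ same = subst (λ z → Reach G z (π b)) (sym same) (reach-contract π edge r)
... | inj₂ e′   = step e′ (reach-contract π edge r)

reach-map : ∀ {H : Graph m} {G : Graph n} (f : Fin m → Fin n) →
            (∀ a b → adj H a b ≡ adj G (f a) (f b)) → ∀ {a b} → Reach H a b → Reach G (f a) (f b)
reach-map f pres = reach-contract f (λ a b e → inj₂ (trans (sym (pres a b)) e))

reach-lift : ∀ {H : Graph m} {G : Graph n} {f} → Embeds H G f →
             ∀ {x y} → Reach G x y → ReachClosed G f x →
             ∀ {a b} → f a ≡ x → f b ≡ y → Reach H a b
reach-lift (inj , _) here _ fa fb = subst (Reach _ _) (inj (trans fa (sym fb))) here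
reach-lift {G = G} (inj , pres) (step {w = w} e r) closed {a} fa fb
  with c , fc ← closed w (step e here) =
  step (trans (pres a c) (trans (cong₂ (adj G) fa fc) e))
       (reach-lift (inj , pres) r (λ u r′ → closed u (step e r′)) fc fb)

adjacency-closed : ∀ (G : Graph n) (f : Fin m → Fin n) →
                   (∀ a u → adj G (f a) u ≡ true → ∃[ b ] f b ≡ u) → ∀ a → ReachClosed G f (f a)
adjacency-closed G f closed a u r = stays r (a , refl)
  where
  stays : ∀ {x y} → Reach G x y → ∃[ b ] f b ≡ x → ∃[ b ] f b ≡ y
  stays here         p          = p
  stays (step e r′) (b , refl) = stays r′ (closed b _ e)

delete : Graph (suc n) → Fin (suc n) → Graph n
delete G v = induced G (punchIn v)

last-visit : ∀ (G : Graph (suc n)) v {u a} → Reach G a (punchIn v u) →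
  (∃[ a′ ] punchIn v a′ ≡ a × Reach (delete G v) a′ u) ⊎
  (∃[ w ] adj G v (punchIn v w) ≡ true × Reach (delete G v) w u)
last-visit G v here = inj₁ (_ , refl , here)
last-visit G v (step {a} e r) with last-visit G v r
... | inj₂ tail = inj₂ tail
... | inj₁ (w , refl , r′) with v ≟ᶠ a
...   | yes refl = inj₂ (w , e , r′)
...   | no v≢a   = inj₁ (punchOut v≢a , punchIn-punchOut v≢a , step e′ r′)
  where
  e′ : adj G (punchIn v (punchOut v≢a)) (punchIn v w) ≡ true
  e′ = subst (λ z → adj G z (punchIn v w) ≡ true) (sym (punchIn-punchOut v≢a)) e

-- Reachability is decidable, by induction on the number of vertices: v reaches
-- u ≠ v iff some neighbour of v reaches u in G − v.
decReach : ∀ (G : Graph n) v u → Dec (Reach G v u)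
decReach {suc n} G v u with v ≟ᶠ u
... | yes refl = yes here
... | no v≢u
  with any? (λ w → (adj G v (punchIn v w) ≟ᵇ true) ×-dec decReach (delete G v) w (punchOut v≢u))
...   | yes (w , e , r) =
  yes (subst (Reach G v) (punchIn-punchOut v≢u) (step e (reach-map (punchIn v) (λ _ _ → refl) r)))
...   | no none =
  no λ r → [ (λ { (a′ , eq , _) → punchInᵢ≢i v a′ eq }) , none ]′
              (last-visit G v (subst (Reach G v) (sym (punchIn-punchOut v≢u)) r))

record Partition {N} (P : Fin N → Set) : Set where
  field
    size₁ size₂ : ℕ
    enum    : (Fin size₁ ⊎ Fin size₂) ↔ Fin N
    inside  : ∀ i → P (Inverse.to enum (inj₁ i))
    outside : ∀ j → ¬ P (Inverse.to enum (inj₂ j))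

consˡ : ∀ {N} → (Fin m₁ ⊎ Fin m₂) ↔ Fin N → (Fin (suc m₁) ⊎ Fin m₂) ↔ Fin (suc N)
consˡ {m₁} {m₂} {N} σ = mk↔ₛ′ to′ from′ to∘from from∘to
  where
  open Inverse σ
  to′ : Fin (suc m₁) ⊎ Fin m₂ → Fin (suc N)
  to′ (inj₁ zero)    = zero
  to′ (inj₁ (suc i)) = suc (to (inj₁ i))
  to′ (inj₂ j)       = suc (to (inj₂ j))
  from′ : Fin (suc N) → Fin (suc m₁) ⊎ Fin m₂
  from′ zero    = inj₁ zero
  from′ (suc u) = map⊎₁ suc (from u)
  to′-shift : ∀ x → to′ (map⊎₁ suc x) ≡ suc (to x)
  to′-shift (inj₁ i) = refl
  to′-shift (inj₂ j) = refl
  to∘from : ∀ u → to′ (from′ u) ≡ u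
  to∘from zero    = refl
  to∘from (suc u) = trans (to′-shift (from u)) (cong suc (strictlyInverseˡ u))
  from∘to : ∀ x → from′ (to′ x) ≡ x
  from∘to (inj₁ zero)    = refl
  from∘to (inj₁ (suc i)) = cong (map⊎₁ suc) (strictlyInverseʳ (inj₁ i))
  from∘to (inj₂ j)       = cong (map⊎₁ suc) (strictlyInverseʳ (inj₂ j))

consʳ : ∀ {N} → (Fin m₁ ⊎ Fin m₂) ↔ Fin N → (Fin m₁ ⊎ Fin (suc m₂)) ↔ Fin (suc N)
consʳ σ = ↔-trans swap-↔ (consˡ (↔-trans swap-↔ σ))

partition : ∀ {N} {P : Fin N → Set} → Decidable P → Partition P
partition {zero} P? = record
  { size₁ = 0 ; size₂ = 0
  ; enum = mk↔ₛ′ [ (λ ()) , (λ ()) ]′ (λ ()) (λ ()) (λ { (inj₁ ()) ; (inj₂ ()) })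
  ; inside = λ () ; outside = λ () }
partition {suc N} {P} P? with P? zero | partition {P = λ u → P (suc u)} (λ u → P? (suc u))
... | yes p | Q = record
  { size₁ = _ ; size₂ = _ ; enum = consˡ enum
  ; inside = λ { zero → p ; (suc i) → inside i } ; outside = outside }
  where open Partition Q
... | no ¬p | Q = record
  { size₁ = _ ; size₂ = _ ; enum = consʳ enum
  ; inside = inside ; outside = λ { zero → ¬p ; (suc j) → outside j } }
  where open Partition Q

components-iso : ∀ {G : Graph n} {H : Graph m} {H′ : Graph k} {f f′ v v′} →
                 IsComponentOf H f G v → IsComponentOf H′ f′ G v′ → Reach G v v′ → H ≅ H′
components-iso {G = G} {H} {H′} {f} {f′}
               (inj , closed , reach , pres) (inj′ , closed′ , reach′ , pres′) r =
  mk↔ₛ′ to from to∘from from∘to , preserves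
  where
  image′ : ∀ i → ∃[ j ] f′ j ≡ f i
  image′ i = closed′ (f i) (reach-trans (reach-sym r) (reach i))
  image : ∀ j → ∃[ i ] f i ≡ f′ j
  image j = closed (f′ j) (reach-trans r (reach′ j))
  to = proj₁ ∘ image′
  from = proj₁ ∘ image
  to∘from : ∀ j → to (from j) ≡ j
  to∘from j = inj′ (trans (proj₂ (image′ (from j))) (proj₂ (image j)))
  from∘to : ∀ i → from (to i) ≡ i
  from∘to i = inj (trans (proj₂ (image (to i))) (proj₂ (image′ i)))
  preserves : ∀ i j → adj H′ (to i) (to j) ≡ adj H i j
  preserves i j =
    trans (pres′ (to i) (to j))
          (trans (cong₂ (adj G) (proj₂ (image′ i)) (proj₂ (image′ j))) (sym (pres i j)))

connected-component : ∀ {G : Graph n} {v} → (∀ u → Reach G v u) → IsComponentOf G id G v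
connected-component conn = id , (λ u _ → u , refl) , conn , (λ _ _ → refl)

isolated-component : ∀ {G : Graph n} {v} → (∀ u → adj G v u ≡ false) →
                     IsComponentOf K1 (λ _ → v) G v
isolated-component {G = G} {v} isolated =
  (λ { {zero} {zero} _ → refl }) , closed , (λ { zero → here }) , (λ { zero zero → sym (adjIrr G v) })
  where
  closed : ReachClosed G (λ _ → v) v
  closed u here = zero , refl
  closed u (step {w = w} e _) with () ← trans (sym e) (isolated w)

record ComponentSplit {n} (G : Graph n) (v : Fin n) : Set where
  field
    size₁ size₂   : ℕ
    embed₁        : Fin size₁ → Fin n
    embed₂        : Fin size₂ → Fin n
    component     : IsComponentOf (induced G embed₁) embed₁ G v
    rest-embeds   : Embeds (induced G embed₂) G embed₂
    rest-closed   : ∀ j → ReachClosed G embed₂ (embed₂ j)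
    decomposition : disjointUnion (induced G embed₁) (induced G embed₂) ≅ G

  covers : ReachClosed G embed₁ v
  covers = proj₁ (proj₂ component)

  reaches : ∀ i → Reach G v (embed₁ i)
  reaches = proj₁ (proj₂ (proj₂ component))

  root : Fin size₁
  root = proj₁ (covers v here)

  root-maps-to-v : embed₁ root ≡ v
  root-maps-to-v = proj₂ (covers v here)

componentSplit : ∀ (G : Graph n) v → ComponentSplit G v
componentSplit {n} G v = record
  { embed₁ = f₁ ; embed₂ = f₂
  ; component = injective₁ , covered₁ , inside , (λ _ _ → refl)
  ; rest-embeds = injective₂ , (λ _ _ → refl)
  ; rest-closed = λ j u r → covered₂ u (λ r₀ → outside j (reach-trans r₀ (reach-sym r)))
  ; decomposition = ↔-trans +↔⊎ enum , preserves }
  where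
  open Partition (partition (decReach G v))
  open Inverse enum
  f₁ = to ∘ inj₁
  f₂ = to ∘ inj₂
  C = induced G f₁
  R = induced G f₂

  injective₁ : Injective _≡_ _≡_ f₁
  injective₁ eq = inj₁-injective (↔-injective enum eq)
  injective₂ : Injective _≡_ _≡_ f₂
  injective₂ eq = inj₂-injective (↔-injective enum eq)

  to-from : ∀ {u x} → from u ≡ x → to x ≡ u
  to-from {u} eq = trans (cong to (sym eq)) (strictlyInverseˡ u)

  covered₁ : ∀ u → Reach G v u → ∃[ i ] f₁ i ≡ u
  covered₁ u r with from u in eq
  ... | inj₁ i = i , to-from eq
  ... | inj₂ j = contradiction (subst (Reach G v) (sym (to-from eq)) r) (outside j)
  covered₂ : ∀ u → ¬ Reach G v u → ∃[ j ] f₂ j ≡ u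
  covered₂ u ¬r with from u in eq
  ... | inj₁ i = contradiction (subst (Reach G v) (to-from eq) (inside i)) ¬r
  ... | inj₂ j = j , to-from eq

  no-edge : ∀ a b → adj G (f₁ a) (f₂ b) ≡ false
  no-edge a b = ¬-not λ e → outside b (reach-trans (inside a) (step e here))

  split : Fin (size₁ + size₂) → Fin n
  split x = to (splitAt size₁ x)
  split-left : ∀ a → split (a ↑ˡ size₂) ≡ f₁ a
  split-left a = cong to (splitAt-↑ˡ size₁ a size₂)
  split-right : ∀ b → split (size₁ ↑ʳ b) ≡ f₂ b
  split-right b = cong to (splitAt-↑ʳ size₁ size₂ b)

  preserves : ∀ x y → adj G (split x) (split y) ≡ adj (disjointUnion C R) x y
  preserves x y with sumView size₁ size₂ x | sumView size₁ size₂ y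
  ... | left a | left b =
    trans (cong₂ (adj G) (split-left a) (split-left b)) (sym (sum-ll C R _ a b))
  ... | left a | right b =
    trans (cong₂ (adj G) (split-left a) (split-right b)) (trans (no-edge a b) (sym (sum-lr C R _ a b)))
  ... | right a | left b =
    trans (cong₂ (adj G) (split-right a) (split-left b))
          (trans (trans (adjSym G (f₂ a) (f₁ b)) (no-edge b a)) (sym (sum-rl C R _ b a)))
  ... | right a | right b =
    trans (cong₂ (adj G) (split-right a) (split-right b)) (sym (sum-rr C R _ a b))

component-pushforward : ∀ {G : Graph n} {G′ : Graph k} {H : Graph m} {e f v} →
                        Embeds G G′ e → ReachClosed G′ e (e v) →
                        IsComponentOf H f G v → IsComponentOf H (e ∘ f) G′ (e v)
component-pushforward {G′ = G′} {e = e} {f} {v} (e-inj , e-pres) e-closed (inj , closed , reach , pres) =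
  (λ eq → inj (e-inj eq)) , ef-closed , (λ i → reach-map e e-pres (reach i)) ,
  (λ i j → trans (pres i j) (e-pres (f i) (f j)))
  where
  ef-closed : ReachClosed G′ (e ∘ f) (e v)
  ef-closed u r with a , refl ← e-closed u r
                 with i , refl ← closed a (reach-lift (e-inj , e-pres) r e-closed refl refl) = i , refl

component-pullback : ∀ {G : Graph n} {G′ : Graph k} {H : Graph m} {e f v} →
                     Embeds G G′ e → ReachClosed G′ e (e v) →
                     IsComponentOf H f G′ (e v) → ∃[ g ] IsComponentOf H g G v
component-pullback {G = G} {G′} {H} {e} {f} {v} (e-inj , e-pres) e-closed (inj , closed , reach , pres) =
  g , g-inj , g-closed , g-reach , g-pres
  where
  preimage : ∀ i → ∃[ a ] e a ≡ f i
  preimage i = e-closed (f i) (reach i)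
  g = proj₁ ∘ preimage
  g-inj : Injective _≡_ _≡_ g
  g-inj {i} {j} eq = inj (trans (sym (proj₂ (preimage i))) (trans (cong e eq) (proj₂ (preimage j))))
  g-closed : ReachClosed G g v
  g-closed u r with i , fi ← closed (e u) (reach-map e e-pres r) =
    i , e-inj (trans (proj₂ (preimage i)) fi)
  g-reach : ∀ i → Reach G v (g i)
  g-reach i = reach-lift (e-inj , e-pres) (reach i) e-closed refl (proj₂ (preimage i))
  g-pres : ∀ i j → adj H i j ≡ adj G (g i) (g j)
  g-pres i j = trans (pres i j) (trans (cong₂ (adj G′) (sym (proj₂ (preimage i))) (sym (proj₂ (preimage j))))
                                       (sym (e-pres (g i) (g j))))

-- If one component at x is OAT then all are, being isomorphic to it.
oat-component : ∀ {G : Graph n} {H : Graph m} {f x} →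
                IsComponentOf H f G x → IsOAT H → ComponentsOATAt G x
oat-component {G = G} {H} {f} {x} c d _ H′ f′ c′ =
  iso d (components-iso {G = G} {H} {H′} {f} {f′} {x} {x} c c′ here)

components-OAT-along : ∀ {G : Graph n} {w x} → Reach G w x → ComponentsOATAt G x → ComponentsOATAt G w
components-OAT-along {G = G} {w} {x} r oat _ H f c =
  iso (oat _ (induced G embed₁) embed₁ component)
      (components-iso {G = G} {H = induced G embed₁} {H} {embed₁} {f} {x} {w} component c (reach-sym r))
  where open ComponentSplit (componentSplit G x)

components-OAT-pullback : ∀ {G : Graph n} {G′ : Graph k} {e v} →
                          Embeds G G′ e → ReachClosed G′ e (e v) →
                          ComponentsOATAt G v → ComponentsOATAt G′ (e v)
components-OAT-pullback {G = G} {G′} {e} {v} emb closed oat _ H f c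
  with g , c′ ← component-pullback {G = G} {G′} {H} {e} {f} {v} emb closed c =
  oat _ H g c′

vertex : ∀ {G : Graph n} → IsOAT G → Fin n
vertex single                          = zero
vertex (iso d (σ , _))                 = Inverse.to σ (vertex d)
vertex (union {n₂ = n₂} d₁ _)          = vertex d₁ ↑ˡ n₂
vertex (joinOp {n₂ = n₂} d₁ _)         = vertex d₁ ↑ˡ n₂
vertex (comparable _ _ _ _)            = zero
vertex (clique v k _)                  = v ↑ˡ k

single-components : AllComponentsOAT K1
single-components zero = oat-component (connected-component λ { zero → here }) single

-- An isomorphism is an embedding onto all vertices, so components pull back along it.
iso-components : ∀ {G : Graph m} {G′ : Graph n} → AllComponentsOAT G → G ≅ G′ → AllComponentsOAT G′
iso-components {G′ = G′} oat (σ , pσ) w =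
  subst (ComponentsOATAt G′) (strictlyInverseˡ w)
    (components-OAT-pullback (↔-injective σ , λ a b → sym (pσ a b))
                             (λ u _ → from u , strictlyInverseˡ u) (oat (from w)))
  where open Inverse σ

-- The two sides of a disjoint union are not adjacent, so each side captures its components.
union-components : ∀ {G₁ : Graph n₁} {G₂ : Graph n₂} →
                   AllComponentsOAT G₁ → AllComponentsOAT G₂ → AllComponentsOAT (disjointUnion G₁ G₂)
union-components {n₁} {n₂} {G₁} {G₂} oat₁ oat₂ w with sumView n₁ n₂ w
... | left a =
  components-OAT-pullback (↑ˡ-injective n₂ _ _ , λ x y → sym (sum-ll G₁ G₂ _ x y))
                          (adjacency-closed (disjointUnion G₁ G₂) (_↑ˡ n₂) stays-left a) (oat₁ a)
  where
  stays-left : ∀ a u → adj (disjointUnion G₁ G₂) (a ↑ˡ n₂) u ≡ true → ∃[ b ] b ↑ˡ n₂ ≡ u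
  stays-left a u e with sumView n₁ n₂ u
  ... | left b  = b , refl
  ... | right b with () ← trans (sym (sum-lr G₁ G₂ _ a b)) e
... | right b =
  components-OAT-pullback (↑ʳ-injective n₁ _ _ , λ x y → sym (sum-rr G₁ G₂ _ x y))
                          (adjacency-closed (disjointUnion G₁ G₂) (n₁ ↑ʳ_) stays-right b) (oat₂ b)
  where
  stays-right : ∀ b u → adj (disjointUnion G₁ G₂) (n₁ ↑ʳ b) u ≡ true → ∃[ c ] n₁ ↑ʳ c ≡ u
  stays-right b u e with sumView n₁ n₂ u
  ... | right c = c , refl
  ... | left a with () ← trans (sym (sum-rl G₁ G₂ _ a b)) e

-- A join of two nonempty graphs is connected.
join-components : ∀ {G₁ : Graph n₁} {G₂ : Graph n₂} → IsOAT G₁ → IsOAT G₂ → AllComponentsOAT (join G₁ G₂)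
join-components {n₁} {n₂} {G₁} {G₂} d₁ d₂ w =
  oat-component (connected-component (connected w)) (joinOp d₁ d₂)
  where
  connected : ∀ x y → Reach (join G₁ G₂) x y
  connected x y with sumView n₁ n₂ x | sumView n₁ n₂ y
  ... | left a  | left b  = step (sum-lr G₁ G₂ _ a (vertex d₂)) (step (sum-rl G₁ G₂ _ b (vertex d₂)) here)
  ... | left a  | right b = step (sum-lr G₁ G₂ _ a b) here
  ... | right a | left b  = step (sum-rl G₁ G₂ _ b a) here
  ... | right a | right b = step (sum-rl G₁ G₂ _ (vertex d₁) a) (step (sum-lr G₁ G₂ _ (vertex d₁) b) here)

module AddComparable {n} {G : Graph n} (v : Fin n) (X : Fin n → Bool)
                     (X⊆Nv : ∀ x → X x ≡ true → adj G v x ≡ true) where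

  G′ = addVertex G X

  -- Identifying the new vertex with v turns walks of G′ into walks of G.
  to-v : Fin (suc n) → Fin n
  to-v zero    = v
  to-v (suc x) = x

  project : ∀ {a b} → Reach G′ a b → Reach G (to-v a) (to-v b)
  project = reach-contract to-v edge
    where
    edge : ∀ a b → adj G′ a b ≡ true → to-v a ≡ to-v b ⊎ adj G (to-v a) (to-v b) ≡ true
    edge zero    (suc x) e = inj₂ (X⊆Nv x e)
    edge (suc x) zero    e = inj₂ (trans (adjSym G x v) (X⊆Nv x e))
    edge (suc x) (suc y) e = inj₂ e

  -- The component of the new vertex is K1, or the component of v with the new vertex added.
  new-component : ComponentsOATAt G v → ComponentsOATAt G′ zero
  new-component oat with any? (λ x → X x ≟ᵇ true)
  ... | no none = oat-component (isolated-component isolated) single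
    where
    isolated : ∀ u → adj G′ zero u ≡ false
    isolated zero    = refl
    isolated (suc x) = ¬-not λ e → none (x , e)
  ... | yes (x₀ , Xx₀) =
    oat-component (proj₁ F-embeds , closed , reach , proj₂ F-embeds)
                  (comparable root (X ∘ f) hyp (oat _ _ f component))
    where
    open ComponentSplit (componentSplit G v) renaming (embed₁ to f)
    F = lift 1 f
    F-embeds : Embeds (addVertex (induced G f) (X ∘ f)) G′ F
    F-embeds = addVertex-embeds {H = induced G f} {G} X (proj₁ component , (λ _ _ → refl))
    hyp : ∀ x → X (f x) ≡ true → adj G (f root) (f x) ≡ true
    hyp x e = trans (cong (λ z → adj G z (f x)) root-maps-to-v) (X⊆Nv (f x) e)
    closed : ReachClosed G′ F zero
    closed zero    _ = zero , refl
    closed (suc b) r with i , fi ← covers b (project r) = suc i , cong suc fi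
    reach : ∀ i → Reach G′ zero (F i)
    reach zero    = here
    reach (suc i) =
      step Xx₀ (reach-map suc (λ _ _ → refl)
        (step (trans (adjSym G x₀ v) (X⊆Nv x₀ Xx₀)) (reaches i)))

  -- Every other component avoids the new vertex and is a component of G.
  components : AllComponentsOAT G → AllComponentsOAT G′
  components oat zero = new-component (oat v)
  components oat (suc a) with decReach G′ (suc a) zero
  ... | yes r = components-OAT-along r (new-component (oat v))
  ... | no ¬r = components-OAT-pullback (suc-injective , λ _ _ → refl) closed (oat a)
    where
    closed : ReachClosed G′ suc (suc a)
    closed zero    r = contradiction r ¬r
    closed (suc b) _ = b , refl

module AttachClique {n} {G : Graph n} (v : Fin n) (k : ℕ) where

  G′ = attachClique G v k

  cross : Fin n → Fin k → Bool
  cross a _ = ⌊ a ≟ᶠ v ⌋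

  v~clique : ∀ c → adj G′ (v ↑ˡ k) (n ↑ʳ c) ≡ true
  v~clique c = trans (sum-lr G (complete k) cross v c) (⌊≟⌋-refl v)

  clique~v : ∀ c → adj G′ (n ↑ʳ c) (v ↑ˡ k) ≡ true
  clique~v c = trans (sum-rl G (complete k) cross v c) (⌊≟⌋-refl v)

  -- Contracting the clique onto v turns walks of G′ into walks of G.
  to-v : Fin (n + k) → Fin n
  to-v x = [ id , (λ _ → v) ]′ (splitAt n x)

  to-v-left : ∀ a → to-v (a ↑ˡ k) ≡ a
  to-v-left a rewrite splitAt-↑ˡ n a k = refl

  to-v-right : ∀ c → to-v (n ↑ʳ c) ≡ v
  to-v-right c rewrite splitAt-↑ʳ n k c = refl

  project : ∀ {a b} → Reach G′ a b → Reach G (to-v a) (to-v b)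
  project = reach-contract to-v edge
    where
    edge : ∀ x y → adj G′ x y ≡ true → to-v x ≡ to-v y ⊎ adj G (to-v x) (to-v y) ≡ true
    edge x y e with sumView n k x | sumView n k y
    ... | left a  | left b  rewrite to-v-left a | to-v-left b =
      inj₂ (trans (sym (sum-ll G (complete k) cross a b)) e)
    ... | left a  | right c rewrite to-v-left a | to-v-right c =
      inj₁ (⌊≟⌋-sound (trans (sym (sum-lr G (complete k) cross a c)) e))
    ... | right c | left b  rewrite to-v-right c | to-v-left b =
      inj₁ (sym (⌊≟⌋-sound (trans (sym (sum-rl G (complete k) cross b c)) e)))
    ... | right c | right d rewrite to-v-right c | to-v-right d = inj₁ refl

  -- The component of v in G′ is the component of v in G with the clique attached.
  new-component : ComponentsOATAt G v → ComponentsOATAt G′ (v ↑ˡ k)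
  new-component oat =
    oat-component (proj₁ F-embeds , closed , reach , proj₂ F-embeds)
                  (clique root k (oat _ _ f component))
    where
    open ComponentSplit (componentSplit G v) renaming (embed₁ to f)
    f-inj = proj₁ component
    F = f ⊕ id
    F-embeds : Embeds (attachClique (induced G f) root k) G′ F
    F-embeds = ⊕-embeds _ cross (f-inj , λ _ _ → refl) (id , λ _ _ → refl) λ a _ →
      ⌊⌋-⇔ (mk⇔ (λ a≡root → trans (cong f a≡root) root-maps-to-v)
                (λ fa≡v → f-inj (trans fa≡v (sym root-maps-to-v))))
           (a ≟ᶠ root) (f a ≟ᶠ v)
    closed : ReachClosed G′ F (v ↑ˡ k)
    closed u r with sumView n k u
    ... | right c = _ ↑ʳ c , ⊕-right f id c
    ... | left b with i , fi ← covers b (subst₂ (Reach G) (to-v-left v) (to-v-left b) (project r)) =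
      i ↑ˡ k , trans (⊕-left f id i) (cong (_↑ˡ k) fi)
    reach : ∀ i → Reach G′ (v ↑ˡ k) (F i)
    reach i with sumView size₁ k i
    ... | left a  = subst (Reach G′ _) (sym (⊕-left f id a))
                      (reach-map (_↑ˡ k) (λ x y → sym (sum-ll G (complete k) cross x y))
                                 (reaches a))
    ... | right c = subst (Reach G′ _) (sym (⊕-right f id c)) (step (v~clique c) here)

  -- Every other component avoids the clique and is a component of G.
  components : AllComponentsOAT G → AllComponentsOAT G′
  components oat w with sumView n k w
  ... | right c = components-OAT-along (step (clique~v c) here) (new-component (oat v))
  ... | left a with decReach G′ (a ↑ˡ k) (v ↑ˡ k)
  ...   | yes r = components-OAT-along r (new-component (oat v))
  ...   | no ¬r =
    components-OAT-pullback (↑ˡ-injective k _ _ , λ x y → sym (sum-ll G (complete k) cross x y)) closed (oat a)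
    where
    closed : ReachClosed G′ (_↑ˡ k) (a ↑ˡ k)
    closed u r with sumView n k u
    ... | left b  = b , refl
    ... | right c = contradiction (reach-trans r (step (clique~v c) here)) ¬r

forward : ∀ {G : Graph n} → IsOAT G → AllComponentsOAT G
forward single                   = single-components
forward (iso d σ)                = iso-components (forward d) σ
forward (union d₁ d₂)            = union-components (forward d₁) (forward d₂)
forward (joinOp d₁ d₂)           = join-components d₁ d₂
forward (comparable v X X⊆Nv d)  = AddComparable.components v X X⊆Nv (forward d)
forward (clique v k d)           = AttachClique.components v k (forward d)

union-empty : ∀ (C : Graph m) (R : Graph 0) → C ≅ disjointUnion C R
union-empty {m} C R = mk↔ₛ′ (_↑ˡ 0) from to∘from from∘to , λ a b → sum-ll C R _ a b
  where
  from : Fin (m + 0) → Fin m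
  from x = [ id , (λ ()) ]′ (splitAt m x)
  from∘to : ∀ a → from (a ↑ˡ 0) ≡ a
  from∘to a rewrite splitAt-↑ˡ m a 0 = refl
  to∘from : ∀ x → from x ↑ˡ 0 ≡ x
  to∘from x with sumView m 0 x
  ... | left a = cong (_↑ˡ 0) (from∘to a)

fewer-vertices : Fin m₁ → m₁ + suc m₂ ≡ suc n → m₂ < n
fewer-vertices {suc m₁} {m₂} _ refl = m≤n+m (suc m₂) m₁

-- Strong induction on the number of vertices: G is the disjoint union of the
-- component C of vertex zero and the rest R, whose components are components of G.
backward : ∀ n (G : Graph (suc n)) → AllComponentsOAT G → IsOAT G
backward = <-rec _ reassemble
  where
  reassemble : ∀ n → (∀ {n′} → n′ < n → (G : Graph (suc n′)) → AllComponentsOAT G → IsOAT G) →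
               (G : Graph (suc n)) → AllComponentsOAT G → IsOAT G
  reassemble n smaller G oat = iso (union-OAT R rest-OAT (↔⇒≡ (proj₁ decomposition))) decomposition
    where
    open ComponentSplit (componentSplit G zero)
    C = induced G embed₁
    R = induced G embed₂
    C-OAT : IsOAT C
    C-OAT = oat zero _ C embed₁ component
    rest-OAT : AllComponentsOAT R
    rest-OAT b _ H f c = oat (embed₂ b) _ H (embed₂ ∘ f)
      (component-pushforward {G = R} {G} {H} {embed₂} {f} {b} rest-embeds (rest-closed b) c)
    union-OAT : ∀ {m} (R′ : Graph m) → AllComponentsOAT R′ → size₁ + m ≡ suc n → IsOAT (disjointUnion C R′)
    union-OAT {zero}  R′ _    _    = iso C-OAT (union-empty C R′)
    union-OAT {suc m} R′ oat′ size = union C-OAT (smaller (fewer-vertices root size) R′ oat′)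

lemma5 : ∀ {n : ℕ} (G : Graph (suc n)) → IsOAT G ⇔ AllComponentsOAT G
lemma5 {n} G = mk⇔ forward (backward n G)
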